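{- Let $G=(V,E)$ be a connected graph and $c:V\to\mathbb{N}$ with $c_v\le d(v)$ for every $v\in V$, where $d(v)$ is the degree of $v$ in $G$. Run the following Edge Addition algorithm: start with $Y=\emptyset$; for each $e\in E$ (in any order), if $Y\cup\{e\}$ is feasible, replace $Y$ by $Y\cup\{e\}$. Let $d_Y(x)$ be the degree of $x$ in $(V,Y)$ and $A=\{v\in V: d_Y(v)<c_v\}$. Let $Z$ be obtained by selecting, for each $v\in A$, arbitrary $c_v-d_Y(v)$ edges of $E\setminus Y$ incident on $v$ and inserting them into $Z$ (initially $Z=\emptyset$). Output $Y$ if $|Y|\ge |Z|$ and $Z$ otherwise. Then this algorithm is a $4$-approximation algorithm for PDBEP: its output is feasible and has cardinality at least $\mathrm{OPT}/4$, where $\mathrm{OPT}$ is the maximum cardinality of a feasible set.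
   Context: Partial Degree Bounded Edge Packing (PDBEP): given a graph $G=(V,E)$ and $c:V\to\mathbb{N}$, a set $E'\subseteq E$ is feasible if for every edge $(u,v)\in E'$ we have $d'_u\le c_u$ or $d'_v\le c_v$, where $d'_x$ denotes the degree of $x$ in $(V,E')$. The problem asks for a feasible set of maximum cardinality $\mathrm{OPT}$. -}

module Defs where

open import Data.Nat using (ℕ; _≤_; _<_; _∸_; _≤?_)
open import Data.Fin using (Fin; _≟_) renaming (_<_ to _<ᶠ_)
open import Data.Product using (_×_; _,_; proj₁; proj₂; ∃)
open import Data.Sum using (_⊎_)
open import Data.Sum.Relation.Unary.All using ()
open import Data.List using (List; []; _∷_; _++_; [_]; length; filter)
open import Data.List.Relation.Unary.All using (All; all?)
open import Data.List.Relation.Unary.Unique.Propositional using (Unique)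
open import Data.List.Membership.Propositional using (_∈_; _∉_)
open import Relation.Nullary using (Dec; yes; no; ¬_)
open import Relation.Nullary.Decidable using (_⊎-dec_)
open import Relation.Binary.PropositionalEquality using (_≡_)

-- Vertices are Fin n; an edge is a pair (u , v) stored canonically with u < v.
Edge : ℕ → Set
Edge n = Fin n × Fin n

Incident : ∀ {n} → Fin n → Edge n → Set
Incident x e = proj₁ e ≡ x ⊎ proj₂ e ≡ x

incident? : ∀ {n} (x : Fin n) (e : Edge n) → Dec (Incident x e)
incident? x e = (proj₁ e ≟ x) ⊎-dec (proj₂ e ≟ x)

deg : ∀ {n} → List (Edge n) → Fin n → ℕ
deg L x = length (filter (incident? x) L)

SimpleGraph : ∀ {n} → List (Edge n) → Set
SimpleGraph E = All (λ e → proj₁ e <ᶠ proj₂ e) E × Unique E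

data Reach {n} (E : List (Edge n)) : Fin n → Fin n → Set where
  here : ∀ {u} → Reach E u u
  fwd  : ∀ {u w v} → (u , w) ∈ E → Reach E w v → Reach E u v
  bwd  : ∀ {u w v} → (w , u) ∈ E → Reach E w v → Reach E u v

Connected : ∀ {n} → List (Edge n) → Set
Connected {n} E = (u v : Fin n) → Reach E u v

Feasible : ∀ {n} → (Fin n → ℕ) → List (Edge n) → Set
Feasible c L =
  All (λ e → deg L (proj₁ e) ≤ c (proj₁ e) ⊎ deg L (proj₂ e) ≤ c (proj₂ e)) L

feasible? : ∀ {n} (c : Fin n → ℕ) (L : List (Edge n)) → Dec (Feasible c L)
feasible? c L =
  all? (λ e → (deg L (proj₁ e) ≤? c (proj₁ e)) ⊎-dec (deg L (proj₂ e) ≤? c (proj₂ e))) L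

edgeAdditionFrom : ∀ {n} → (Fin n → ℕ) → List (Edge n) → List (Edge n) → List (Edge n)
edgeAdditionFrom c Y [] = Y
edgeAdditionFrom c Y (e ∷ es) with feasible? c (Y ++ [ e ])
... | yes _ = edgeAdditionFrom c (Y ++ [ e ]) es
... | no  _ = edgeAdditionFrom c Y es

edgeAddition : ∀ {n} → (Fin n → ℕ) → List (Edge n) → List (Edge n)
edgeAddition c E = edgeAdditionFrom c [] E

ValidSelection : ∀ {n} → (Fin n → ℕ) → List (Edge n) → List (Edge n)
               → (Fin n → List (Edge n)) → Set
ValidSelection {n} c E Y S = (v : Fin n) →
  (deg Y v < c v →
     Unique (S v) × length (S v) ≡ c v ∸ deg Y v
     × All (λ e → e ∈ E × e ∉ Y × Incident v e) (S v))
  × (¬ (deg Y v < c v) → S v ≡ [])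

IsUnionOf : ∀ {n} → (Fin n → List (Edge n)) → List (Edge n) → Set
IsUnionOf {n} S Z =
  Unique Z × (∀ e → (e ∈ Z → ∃ λ (v : Fin n) → e ∈ S v) × ((v : Fin n) → e ∈ S v → e ∈ Z))

choose : ∀ {n} → List (Edge n) → List (Edge n) → List (Edge n)
choose Y Z with length Z ≤? length Y
... | yes _ = Y
... | no  _ = Z

-- Idea. (1) The scan of Edge Addition keeps Y feasible, and Y is maximal: an edge of
-- E rejected by the scan has an endpoint saturated in Y (d_Y ≥ c), since degrees only
-- grow. (2) Hence at an unsaturated vertex v every Z-edge incident on v was selected by
-- v itself (otherwise both endpoints would be unsaturated), so d_Z(v) ≤ c_v - d_Y(v);
-- every Z-edge was selected by such a v, so Z is feasible. (3) For every vertex,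
-- c_v ≤ d_Y(v) + d_Z(v). (4) Charging each edge of a feasible F to an endpoint within
-- capacity gives |F| ≤ Σ_v c_v ≤ Σ_v d_Y(v) + Σ_v d_Z(v) ≤ 2|Y| + 2|Z| by the
-- handshake inequality, and 2|Y| + 2|Z| ≤ 4 max(|Y|, |Z|).
module Submission where

open import Defs
open import Data.Nat using (ℕ; zero; suc; _+_; _*_; _∸_; _≤_; _<_; z≤n; s≤s; _≤?_; _<?_)
open import Data.Nat.Properties
  using (≤-trans; ≤-reflexive; <⇒≤; ≤-<-trans; ≮⇒≥; ≰⇒>; m≤m+n; m∸n≤m; m≤n+m∸n;
         +-mono-≤; +-monoʳ-≤; +-monoˡ-≤; *-monoʳ-≤; +-comm; +-identityʳ; *-identityˡ; *-distribˡ-+;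
         *-distribʳ-+; +-0-commutativeMonoid; module ≤-Reasoning)
open import Data.Fin using (Fin; _≟_; punchIn) renaming (zero to fzero; suc to fsuc)
open import Data.Fin.Properties using (punchInᵢ≢i)
open import Data.Product as Product using (_×_; _,_; proj₁; proj₂; ∃)
open import Data.Sum as Sum using (_⊎_; inj₁; inj₂)
open import Data.Empty using (⊥; ⊥-elim)
open import Data.List using (List; []; _∷_; _++_; [_]; length; filter)
open import Data.List.Properties using (length-++; filter-++; length-filter; filter-accept; filter-reject; length-++-sucʳ; ++-assoc; ++-identityʳ)
open import Data.List.Relation.Unary.All as All using (All; []; _∷_)
open import Data.List.Relation.Unary.All.Properties using (++⁺)
open import Data.List.Relation.Unary.Any using (here; there)
open import Data.List.Relation.Unary.Unique.Propositional using (Unique)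
open import Data.List.Relation.Unary.Unique.Propositional.Properties using (filter⁺)
open import Data.List.Relation.Unary.AllPairs using (_∷_)
open import Data.List.Relation.Binary.Subset.Propositional using (_⊆_)
open import Data.List.Membership.Propositional using (_∈_; _∉_)
open import Data.List.Membership.Propositional.Properties
  using (∈-∃++; ∈-++⁻; ∈-++⁺ˡ; ∈-++⁺ʳ; ∈-filter⁺; ∈-filter⁻)
open import Algebra.Properties.CommutativeMonoid.Sum +-0-commutativeMonoid
  using (sum; sum-remove; ∑-distrib-+; sum-cong-≗; sum-replicate-zero)
open import Relation.Nullary using (Dec; yes; no; ¬_)
open import Relation.Unary using (Pred; Decidable)
open import Relation.Binary.PropositionalEquality using (_≡_; _≢_; refl; sym; trans; cong; cong₂; subst; module ≡-Reasoning)

unique-⊆-length : {A : Set} {xs ys : List A} → Unique xs → xs ⊆ ys → length xs ≤ length ys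
unique-⊆-length {xs = []} _ _ = z≤n
unique-⊆-length {xs = x ∷ xs} {ys} (x∉xs ∷ xs-unique) xs⊆ys with ∈-∃++ (xs⊆ys (here refl))
... | ys₁ , ys₂ , refl = ≤-trans (s≤s (unique-⊆-length xs-unique xs⊆ys₁ys₂))
                                 (≤-reflexive (sym (length-++-sucʳ ys₁ x ys₂)))
  where
  xs⊆ys₁ys₂ : xs ⊆ ys₁ ++ ys₂
  xs⊆ys₁ys₂ {y} y∈xs with ∈-++⁻ ys₁ (xs⊆ys (there y∈xs))
  ... | inj₁ y∈ys₁         = ∈-++⁺ˡ y∈ys₁
  ... | inj₂ (here refl)   = ⊥-elim (All.lookup x∉xs y∈xs refl)
  ... | inj₂ (there y∈ys₂) = ∈-++⁺ʳ ys₁ y∈ys₂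

∑-mono-≤ : ∀ {n} {f g : Fin n → ℕ} → (∀ i → f i ≤ g i) → sum f ≤ sum g
∑-mono-≤ {zero}  f≤g = z≤n
∑-mono-≤ {suc n} f≤g = +-mono-≤ (f≤g fzero) (∑-mono-≤ (λ i → f≤g (fsuc i)))

term≤∑ : ∀ {n} (f : Fin n → ℕ) (a : Fin n) → f a ≤ sum f
term≤∑ {suc n} f a = ≤-trans (m≤m+n (f a) _) (≤-reflexive (sym (sum-remove {i = a} f)))

∑-single : ∀ {n} (f : Fin n → ℕ) (a : Fin n) → (∀ i → i ≢ a → f i ≡ 0) → sum f ≡ f a
∑-single {suc n} f a vanish = begin
  sum f                               ≡⟨ sum-remove {i = a} f ⟩
  f a + sum (λ j → f (punchIn a j))   ≡⟨ cong (f a +_) (sum-cong-≗ (λ j → vanish _ (punchInᵢ≢i a j))) ⟩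
  f a + sum {n} (λ _ → 0)             ≡⟨ cong (f a +_) (sum-replicate-zero n) ⟩
  f a + 0                             ≡⟨ +-identityʳ (f a) ⟩
  f a                                 ∎
  where open ≡-Reasoning

𝟙 : ∀ {p} {P : Set p} → Dec P → ℕ
𝟙 (yes _) = 1
𝟙 (no _)  = 0

𝟙-true : ∀ {p} {P : Set p} (d : Dec P) → P → 𝟙 d ≡ 1
𝟙-true (yes _) _  = refl
𝟙-true (no ¬p) p  = ⊥-elim (¬p p)

𝟙-false : ∀ {p} {P : Set p} (d : Dec P) → ¬ P → 𝟙 d ≡ 0
𝟙-false (yes p) ¬p = ⊥-elim (¬p p)
𝟙-false (no _)  _  = refl

∑-𝟙≟ : ∀ {n} (a : Fin n) → sum (λ v → 𝟙 (a ≟ v)) ≡ 1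
∑-𝟙≟ a = trans (∑-single (λ v → 𝟙 (a ≟ v)) a (λ v v≢a → 𝟙-false (a ≟ v) (λ a≡v → v≢a (sym a≡v))))
               (𝟙-true (a ≟ a) refl)

deg-++ : ∀ {n} (L M : List (Edge n)) (v : Fin n) → deg (L ++ M) v ≡ deg L v + deg M v
deg-++ L M v = trans (cong length (filter-++ (incident? v) L M)) (length-++ (filter (incident? v) L))

deg-edge≤endpoints : ∀ {n} (e : Edge n) (v : Fin n)
                   → deg [ e ] v ≤ 𝟙 (proj₁ e ≟ v) + 𝟙 (proj₂ e ≟ v)
deg-edge≤endpoints e v with proj₁ e ≟ v | proj₂ e ≟ v
... | yes _ | _     = s≤s z≤n
... | no _  | yes _ = s≤s z≤n
... | no _  | no _  = z≤n

deg-edge≤1 : ∀ {n} (e : Edge n) (v : Fin n) → deg [ e ] v ≤ 1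
deg-edge≤1 e v = length-filter (incident? v) [ e ]

deg-edge-incident : ∀ {n} {e : Edge n} {v : Fin n} → Incident v e → deg [ e ] v ≡ 1
deg-edge-incident {v = v} v∈e = cong length (filter-accept (incident? v) v∈e)

handshake : ∀ {n} (L : List (Edge n)) → sum (deg L) ≤ 2 * length L
handshake {n} [] = ≤-reflexive (sum-replicate-zero n)
handshake (e ∷ L) = begin
  sum (deg (e ∷ L))                     ≡⟨ sum-cong-≗ (deg-++ [ e ] L) ⟩
  sum (λ v → deg [ e ] v + deg L v)     ≡⟨ ∑-distrib-+ (deg [ e ]) (deg L) ⟩
  sum (deg [ e ]) + sum (deg L)         ≤⟨ +-mono-≤ edge≤2 (handshake L) ⟩
  2 + 2 * length L                      ≡⟨ sym (*-distribˡ-+ 2 1 (length L)) ⟩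
  2 * length (e ∷ L)                    ∎
  where
  open ≤-Reasoning
  edge≤2 : sum (deg [ e ]) ≤ 2
  edge≤2 = begin
    sum (deg [ e ])                                                ≤⟨ ∑-mono-≤ (deg-edge≤endpoints e) ⟩
    sum (λ v → 𝟙 (proj₁ e ≟ v) + 𝟙 (proj₂ e ≟ v))                  ≡⟨ ∑-distrib-+ (λ v → 𝟙 (proj₁ e ≟ v)) (λ v → 𝟙 (proj₂ e ≟ v)) ⟩
    sum (λ v → 𝟙 (proj₁ e ≟ v)) + sum (λ v → 𝟙 (proj₂ e ≟ v))      ≡⟨ cong₂ _+_ (∑-𝟙≟ (proj₁ e)) (∑-𝟙≟ (proj₂ e)) ⟩
    2                                                              ∎

endpoint-witness : ∀ {n p} (P : Fin n → Set p) {e : Edge n}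
                 → P (proj₁ e) ⊎ P (proj₂ e) → ∃ λ v → Incident v e × P v
endpoint-witness P (inj₁ p₁) = _ , inj₁ refl , p₁
endpoint-witness P (inj₂ p₂) = _ , inj₂ refl , p₂

incident-endpoint : ∀ {n p} (P : Fin n → Set p) {e : Edge n} {v : Fin n}
                  → Incident v e → P v → P (proj₁ e) ⊎ P (proj₂ e)
incident-endpoint P (inj₁ refl) pv = inj₁ pv
incident-endpoint P (inj₂ refl) pv = inj₂ pv

covered-length : ∀ {n t} {T : Pred (Fin n) t} (T? : Decidable T) (L : List (Edge n))
               → All (λ e → ∃ λ v → Incident v e × T v) L
               → length L ≤ sum (λ w → 𝟙 (T? w) * deg L w)
covered-length T? []      []                          = z≤n
covered-length T? (e ∷ L) ((v , v∈e , v∈T) ∷ covered) = begin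
  1 + length L
    ≤⟨ +-mono-≤ charge-e (covered-length T? L covered) ⟩
  sum (λ w → 𝟙 (T? w) * deg [ e ] w) + sum (λ w → 𝟙 (T? w) * deg L w)
    ≡⟨ ∑-distrib-+ (λ w → 𝟙 (T? w) * deg [ e ] w) (λ w → 𝟙 (T? w) * deg L w) ⟨
  sum (λ w → 𝟙 (T? w) * deg [ e ] w + 𝟙 (T? w) * deg L w)
    ≡⟨ sum-cong-≗ (λ w → trans (cong (𝟙 (T? w) *_) (deg-++ [ e ] L w))
                               (*-distribˡ-+ (𝟙 (T? w)) (deg [ e ] w) (deg L w))) ⟨
  sum (λ w → 𝟙 (T? w) * deg (e ∷ L) w) ∎
  where
  open ≤-Reasoning
  charge-e : 1 ≤ sum (λ w → 𝟙 (T? w) * deg [ e ] w)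
  charge-e = ≤-trans (≤-reflexive (sym (cong₂ _*_ (𝟙-true (T? v) v∈T) (deg-edge-incident v∈e))))
                     (term≤∑ (λ w → 𝟙 (T? w) * deg [ e ] w) v)

-- A feasible edge set has at most Σ_v c_v edges: charge each edge to an endpoint
-- whose degree respects its capacity.
feasible-length : ∀ {n} (c : Fin n → ℕ) (F : List (Edge n)) → Feasible c F → length F ≤ sum c
feasible-length {n} c F feasible = begin
  length F                                    ≤⟨ covered-length within? F (All.map (endpoint-witness Within) feasible) ⟩
  sum (λ v → 𝟙 (within? v) * deg F v)        ≤⟨ ∑-mono-≤ charged≤capacity ⟩
  sum c                                       ∎
  where
  open ≤-Reasoning
  Within : Fin n → Set
  Within v = deg F v ≤ c v
  within? : Decidable Within
  within? v = deg F v ≤? c v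
  charged≤capacity : ∀ v → 𝟙 (within? v) * deg F v ≤ c v
  charged≤capacity v with within? v
  ... | yes deg≤c = ≤-trans (≤-reflexive (*-identityˡ (deg F v))) deg≤c
  ... | no _      = z≤n

Unsaturated : ∀ {n} → (Fin n → ℕ) → List (Edge n) → Fin n → Set
Unsaturated c Y v = deg Y v < c v

-- Y is maximal in E: no edge of E outside Y has two unsaturated endpoints
-- (such an edge could be added to Y keeping it feasible).
Maximal : ∀ {n} → (Fin n → ℕ) → List (Edge n) → List (Edge n) → Set
Maximal c E Y = ∀ {e} → e ∈ E → e ∉ Y
              → Unsaturated c Y (proj₁ e) → Unsaturated c Y (proj₂ e) → ⊥

deg-++ˡ : ∀ {n} (L M : List (Edge n)) (v : Fin n) → deg L v ≤ deg (L ++ M) v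
deg-++ˡ L M v = ≤-trans (m≤m+n (deg L v) (deg M v)) (≤-reflexive (sym (deg-++ L M v)))

deg-snoc≤ : ∀ {n} (Y : List (Edge n)) (e : Edge n) (v : Fin n) → deg (Y ++ [ e ]) v ≤ suc (deg Y v)
deg-snoc≤ Y e v = begin
  deg (Y ++ [ e ]) v    ≡⟨ deg-++ Y [ e ] v ⟩
  deg Y v + deg [ e ] v ≤⟨ +-monoʳ-≤ (deg Y v) (deg-edge≤1 e v) ⟩
  deg Y v + 1           ≡⟨ +-comm (deg Y v) 1 ⟩
  suc (deg Y v)         ∎
  where open ≤-Reasoning

deg-snoc-¬incident : ∀ {n} (Y : List (Edge n)) {e : Edge n} {v : Fin n}
                   → ¬ Incident v e → deg (Y ++ [ e ]) v ≡ deg Y v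
deg-snoc-¬incident Y {e} {v} v∉e = begin
  deg (Y ++ [ e ]) v    ≡⟨ deg-++ Y [ e ] v ⟩
  deg Y v + deg [ e ] v ≡⟨ cong (λ k → deg Y v + length k) (filter-reject (incident? v) v∉e) ⟩
  deg Y v + 0           ≡⟨ +-identityʳ (deg Y v) ⟩
  deg Y v               ∎
  where open ≡-Reasoning

add-feasible : ∀ {n} (c : Fin n → ℕ) (Y : List (Edge n)) (e : Edge n) → Feasible c Y
             → Unsaturated c Y (proj₁ e) → Unsaturated c Y (proj₂ e) → Feasible c (Y ++ [ e ])
add-feasible c Y e feasible unsat₁ unsat₂ =
  ++⁺ (All.map (Sum.map still-within still-within) feasible)
      (inj₁ (≤-trans (deg-snoc≤ Y e (proj₁ e)) unsat₁) ∷ [])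
  where
  still-within : ∀ {w} → deg Y w ≤ c w → deg (Y ++ [ e ]) w ≤ c w
  still-within {w} within with incident? w e
  ... | yes (inj₁ refl) = ≤-trans (deg-snoc≤ Y e w) unsat₁
  ... | yes (inj₂ refl) = ≤-trans (deg-snoc≤ Y e w) unsat₂
  ... | no w∉e          = subst (_≤ c w) (sym (deg-snoc-¬incident Y w∉e)) within

module EdgeAddition {n : ℕ} (c : Fin n → ℕ) where

  extends : ∀ (Y es : List (Edge n)) → ∃ λ R → edgeAdditionFrom c Y es ≡ Y ++ R
  extends Y []       = [] , sym (++-identityʳ Y)
  extends Y (e ∷ es) with feasible? c (Y ++ [ e ])
  ... | no _  = extends Y es
  ... | yes _ with extends (Y ++ [ e ]) es
  ...   | R , result≡ = e ∷ R , trans result≡ (++-assoc Y [ e ] R)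

  deg-grows : ∀ (Y es : List (Edge n)) (v : Fin n) → deg Y v ≤ deg (edgeAdditionFrom c Y es) v
  deg-grows Y es v with extends Y es
  ... | R , result≡ = subst (λ L → deg Y v ≤ deg L v) (sym result≡) (deg-++ˡ Y R v)

  keeps : ∀ (Y es : List (Edge n)) {e : Edge n} → e ∈ Y → e ∈ edgeAdditionFrom c Y es
  keeps Y es e∈Y with extends Y es
  ... | R , result≡ = subst (_ ∈_) (sym result≡) (∈-++⁺ˡ e∈Y)

  feasible : ∀ (Y es : List (Edge n)) → Feasible c Y → Feasible c (edgeAdditionFrom c Y es)
  feasible Y []       feasible-Y = feasible-Y
  feasible Y (e ∷ es) feasible-Y with feasible? c (Y ++ [ e ])
  ... | yes feasible-Ye = feasible (Y ++ [ e ]) es feasible-Ye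
  ... | no _            = feasible Y es feasible-Y

  -- a rejected edge had a saturated endpoint when it was rejected, and
  -- degrees only grow afterwards
  maximal : ∀ (Y es : List (Edge n)) → Feasible c Y → Maximal c es (edgeAdditionFrom c Y es)
  maximal Y (e ∷ es) feasible-Y (here refl) e∉result unsat₁ unsat₂ with feasible? c (Y ++ [ e ])
  ... | yes _          = e∉result (keeps (Y ++ [ e ]) es (∈-++⁺ʳ Y (here refl)))
  ... | no infeasible  = infeasible (add-feasible c Y e feasible-Y
                                       (≤-<-trans (deg-grows Y es (proj₁ e)) unsat₁)
                                       (≤-<-trans (deg-grows Y es (proj₂ e)) unsat₂))
  maximal Y (e ∷ es) feasible-Y (there f∈es) with feasible? c (Y ++ [ e ])
  ... | yes feasible-Ye = maximal (Y ++ [ e ]) es feasible-Ye f∈es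
  ... | no _            = maximal Y es feasible-Y f∈es

distinct-endpoints : ∀ {n p} (P : Fin n → Set p) {e : Edge n} {v w : Fin n}
                   → Incident v e → Incident w e → v ≢ w → P v → P w → P (proj₁ e) × P (proj₂ e)
distinct-endpoints P (inj₁ refl) (inj₁ refl) v≢w _  _  = ⊥-elim (v≢w refl)
distinct-endpoints P (inj₁ refl) (inj₂ refl) _   pv pw = pv , pw
distinct-endpoints P (inj₂ refl) (inj₁ refl) _   pv pw = pw , pv
distinct-endpoints P (inj₂ refl) (inj₂ refl) v≢w _  _  = ⊥-elim (v≢w refl)

module Selection {n : ℕ} (c : Fin n → ℕ) (E Y : List (Edge n))
                 (S : Fin n → List (Edge n)) (Z : List (Edge n))
                 (valid : ValidSelection c E Y S) (union : IsUnionOf S Z)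
                 (maximal : Maximal c E Y) where

  selector-unsaturated : ∀ {v e} → e ∈ S v → Unsaturated c Y v
  selector-unsaturated {v} e∈Sv with deg Y v <? c v
  ... | yes unsat = unsat
  ... | no saturated with subst (_ ∈_) (proj₂ (valid v) saturated) e∈Sv
  ...   | ()

  selected-edge : ∀ {v e} → e ∈ S v → e ∈ E × e ∉ Y × Incident v e
  selected-edge {v} e∈Sv = All.lookup (proj₂ (proj₂ (proj₁ (valid v) (selector-unsaturated e∈Sv)))) e∈Sv

  -- At an unsaturated vertex v, every Z-edge incident on v was selected by v itself:
  -- had it been selected by another vertex w, both of its endpoints would be
  -- unsaturated, contradicting maximality of Y.
  Z-local : ∀ v → Unsaturated c Y v → filter (incident? v) Z ⊆ S v
  Z-local v unsat-v {e} e∈Zv with ∈-filter⁻ (incident? v) {xs = Z} e∈Zv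
  ... | e∈Z , v∈e with proj₁ (proj₂ union e) e∈Z
  ...   | w , e∈Sw with v ≟ w
  ...     | yes refl = e∈Sw
  ...     | no v≢w with selected-edge e∈Sw
  ...       | e∈E , e∉Y , w∈e =
    ⊥-elim (Product.uncurry (maximal e∈E e∉Y)
      (distinct-endpoints (Unsaturated c Y) v∈e w∈e v≢w unsat-v (selector-unsaturated e∈Sw)))

  -- so an unsaturated vertex receives exactly its c_v - d_Y(v) selected edges in Z
  deg-Z≤ : ∀ v → Unsaturated c Y v → deg Z v ≤ c v
  deg-Z≤ v unsat-v = begin
    deg Z v          ≤⟨ unique-⊆-length (filter⁺ (incident? v) (proj₁ union)) (Z-local v unsat-v) ⟩
    length (S v)     ≡⟨ proj₁ (proj₂ (proj₁ (valid v) unsat-v)) ⟩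
    c v ∸ deg Y v    ≤⟨ m∸n≤m (c v) (deg Y v) ⟩
    c v              ∎
    where open ≤-Reasoning

  -- every edge of Z was selected by an unsaturated endpoint, whose Z-degree is within capacity
  Z-feasible : Feasible c Z
  Z-feasible = All.tabulate λ {e} e∈Z → selected-within (proj₁ (proj₂ union e) e∈Z)
    where
    selected-within : ∀ {e} → (∃ λ v → e ∈ S v)
                    → deg Z (proj₁ e) ≤ c (proj₁ e) ⊎ deg Z (proj₂ e) ≤ c (proj₂ e)
    selected-within (v , e∈Sv) = incident-endpoint (λ w → deg Z w ≤ c w)
      (proj₂ (proj₂ (selected-edge e∈Sv))) (deg-Z≤ v (selector-unsaturated e∈Sv))

  capacity-covered : ∀ v → c v ≤ deg Y v + deg Z v
  capacity-covered v with deg Y v <? c v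
  ... | no saturated = ≤-trans (≮⇒≥ saturated) (m≤m+n (deg Y v) (deg Z v))
  ... | yes unsat-v = begin
    c v                      ≤⟨ m≤n+m∸n (c v) (deg Y v) ⟩
    deg Y v + (c v ∸ deg Y v) ≡⟨ cong (deg Y v +_) selection-size ⟨
    deg Y v + length (S v)   ≤⟨ +-monoʳ-≤ (deg Y v) (unique-⊆-length selection-unique S⊆Zv) ⟩
    deg Y v + deg Z v        ∎
    where
    open ≤-Reasoning
    selection-unique : Unique (S v)
    selection-unique = proj₁ (proj₁ (valid v) unsat-v)
    selection-size : length (S v) ≡ c v ∸ deg Y v
    selection-size = proj₁ (proj₂ (proj₁ (valid v) unsat-v))
    S⊆Zv : S v ⊆ filter (incident? v) Z
    S⊆Zv e∈Sv = ∈-filter⁺ (incident? v) (proj₂ (proj₂ union _) v e∈Sv) (proj₂ (proj₂ (selected-edge e∈Sv)))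

covering-bound : ∀ {n} (c : Fin n → ℕ) (Y Z F : List (Edge n))
               → (∀ v → c v ≤ deg Y v + deg Z v) → Feasible c F
               → length F ≤ 2 * length Y + 2 * length Z
covering-bound c Y Z F covered feasible = begin
  length F                        ≤⟨ feasible-length c F feasible ⟩
  sum c                           ≤⟨ ∑-mono-≤ covered ⟩
  sum (λ v → deg Y v + deg Z v)   ≡⟨ ∑-distrib-+ (deg Y) (deg Z) ⟩
  sum (deg Y) + sum (deg Z)       ≤⟨ +-mono-≤ (handshake Y) (handshake Z) ⟩
  2 * length Y + 2 * length Z     ∎
  where open ≤-Reasoning

choose-feasible : ∀ {n} (c : Fin n → ℕ) (Y Z : List (Edge n))
                → Feasible c Y → Feasible c Z → Feasible c (choose Y Z)
choose-feasible c Y Z feasible-Y feasible-Z with length Z ≤? length Y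
... | yes _ = feasible-Y
... | no _  = feasible-Z

choose-bound : ∀ {n} (Y Z : List (Edge n)) → 2 * length Y + 2 * length Z ≤ 4 * length (choose Y Z)
choose-bound Y Z with length Z ≤? length Y
... | yes Z≤Y = ≤-trans (+-monoʳ-≤ (2 * length Y) (*-monoʳ-≤ 2 Z≤Y))
                        (≤-reflexive (sym (*-distribʳ-+ (length Y) 2 2)))
... | no Z≰Y  = ≤-trans (+-monoˡ-≤ (2 * length Z) (*-monoʳ-≤ 2 (<⇒≤ (≰⇒> Z≰Y))))
                        (≤-reflexive (sym (*-distribʳ-+ (length Z) 2 2)))

-- Y = edgeAddition c E is feasible and maximal,
-- so Z is feasible and Y, Z together cover all capacities; the larger of the two has
-- at least a quarter of the edges of any feasible set.
theorem1 : (n : ℕ) (E : List (Edge n)) (c : Fin n → ℕ)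
    → SimpleGraph E → Connected E
    → ((v : Fin n) → c v ≤ deg E v)
    → (S : Fin n → List (Edge n)) (Z : List (Edge n))
    → ValidSelection c E (edgeAddition c E) S
    → IsUnionOf S Z
    → Feasible c (choose (edgeAddition c E) Z)
      × ((F : List (Edge n)) → F ⊆ E → Unique F → Feasible c F
           → length F ≤ 4 * length (choose (edgeAddition c E) Z))
theorem1 n E c _ _ _ S Z valid union =
  choose-feasible c Y Z Y-feasible Z-feasible ,
  λ F _ _ F-feasible → ≤-trans (covering-bound c Y Z F capacity-covered F-feasible) (choose-bound Y Z)
  where
  Y : List (Edge n)
  Y = edgeAddition c E
  Y-feasible : Feasible c Y
  Y-feasible = EdgeAddition.feasible c [] E []
  open Selection c E Y S Z valid union (EdgeAddition.maximal c [] E [])
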